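{- Let $H$ be a hypergraph and $U\subseteq V(H)$. Then: (1) every vertex $u\in V(\mathrm{Torso}^*(H,U))\setminus V(\mathrm{Torso}(H,U))$ is simplicial, i.e. any two distinct neighbours $v_1,v_2$ of $u$ in $\mathrm{Torso}^*(H,U)$ are adjacent in $\mathrm{Torso}(H,U)$; (2) for $u_1,u_2\in U$ and $X\subseteq U\setminus\{u_1,u_2\}$, $X$ is a $u_1,u_2$-separator in $\mathrm{Torso}(H,U)$ if and only if $X$ is a $u_1,u_2$-separator in $\mathrm{Torso}^*(H,U)$; (3) $tw(\mathrm{Torso}^*(H,U))\le tw(\mathrm{Torso}(H,U))+1$; (4) if $G$ is the incidence graph of $H$, then $\mathrm{Torso}(H,U)=\mathrm{Torso}(G,U)$.
   Context: A hypergraph $H$ has a finite vertex set $V(H)$ and a family $E(H)$ of subsets (hyperedges), with no isolated vertices. A path in $H$ is a sequence of vertices with consecutive vertices in a common hyperedge (paths in graphs as usual). For $U\subseteq V(H)$, $\mathrm{Torso}(H,U)$ is the graph with vertex set $U$ in which distinct $u,v$ are adjacent iff $H$ has a path from $u$ to $v$ all of whose intermediate vertices lie outside $U$; $\mathrm{Torso}(G,U)$ for a graph $G$ is defined in the same way. The extended torso $\mathrm{Torso}^*(H,U)$ is obtained from $\mathrm{Torso}(H,U)$ by adding, for each hyperedge $e_i$ of $H$ with $e_i\cap U\ne\emptyset$, a new vertex $u_i$ adjacent to exactly the vertices of $U\cap e_i$. The incidence graph $G$ of $H$ is the bipartite graph with vertex set $V(H)\cup E(H)$ in which $v\in V(H)$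 is adjacent to $e\in E(H)$ iff $v\in e$. A $u_1,u_2$-separator in a graph is a vertex set not containing $u_1,u_2$ whose deletion leaves no $u_1$–$u_2$ path. $tw$ denotes treewidth. -}

module Defs where

open import Data.Nat using (ℕ; suc; _≤_)
open import Data.Fin using (Fin)
open import Data.Fin.Subset using (Subset; _∈_; _∉_; _⊆_; _∩_; Nonempty)
open import Data.List using (List; []; _∷_; _++_; length)
open import Data.List.Membership.Propositional renaming (_∈_ to _∈L_)
open import Data.List.Relation.Unary.Unique.Propositional using (Unique)
open import Data.List.Relation.Unary.Linked using (Linked)
open import Data.Product using (Σ; ∃; _×_; _,_; proj₁; proj₂)
open import Data.Sum using (_⊎_; inj₁; inj₂)
open import Data.Empty using (⊥)
open import Data.Unit using (⊤)
open import Relation.Nullary using (¬_)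
open import Relation.Binary.PropositionalEquality using (_≡_; _≢_)

record Hypergraph : Set where
  field
    n    : ℕ
    m    : ℕ
    edge : Fin m → Subset n
    noIsolated : ∀ (v : Fin n) → ∃ λ (i : Fin m) → v ∈ edge i

record Graph : Set₁ where
  field
    V   : Set
    Adj : V → V → Set

data InnerPath {V : Set} (R : V → V → Set) (P : V → Set) : V → V → Set where
  direct : ∀ {u v} → R u v → InnerPath R P u v
  via    : ∀ {u w v} → R u w → P w → InnerPath R P w v → InnerPath R P u v

data Walk {V : Set} (R : V → V → Set) (P : V → Set) : V → V → Set where
  here : ∀ {u} → P u → Walk R P u u
  step : ∀ {u w v} → P u → R u w → Walk R P w v → Walk R P u v

Torso : (G : Graph) → (Graph.V G → Set) → Graph
Torso G U = record
  { V   = Σ (Graph.V G) U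
  ; Adj = λ a b → (proj₁ a ≢ proj₁ b)
                  × InnerPath (Graph.Adj G) (λ w → ¬ U w) (proj₁ a) (proj₁ b) }

Separator : (G : Graph) → (Graph.V G → Set) → Graph.V G → Graph.V G → Set
Separator G X u₁ u₂ =
  ¬ X u₁ × ¬ X u₂ × ¬ Walk (Graph.Adj G) (λ w → ¬ X w) u₁ u₂

module _ (H : Hypergraph) where
  open Hypergraph H

  HStep : Fin n → Fin n → Set
  HStep x y = ∃ λ (i : Fin m) → x ∈ edge i × y ∈ edge i

  TorsoH : Subset n → Graph
  TorsoH U = Torso (record { V = Fin n ; Adj = HStep }) (λ v → v ∈ U)

  NewVertex : Subset n → Set
  NewVertex U = Σ (Fin m) (λ i → Nonempty (edge i ∩ U))

  TorsoStarAdj : (U : Subset n) →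
    (Graph.V (TorsoH U) ⊎ NewVertex U) → (Graph.V (TorsoH U) ⊎ NewVertex U) → Set
  TorsoStarAdj U (inj₁ a) (inj₁ b) = Graph.Adj (TorsoH U) a b
  TorsoStarAdj U (inj₁ a) (inj₂ x) = proj₁ a ∈ edge (proj₁ x)
  TorsoStarAdj U (inj₂ x) (inj₁ a) = proj₁ a ∈ edge (proj₁ x)
  TorsoStarAdj U (inj₂ x) (inj₂ y) = ⊥

  TorsoStar : Subset n → Graph
  TorsoStar U = record { V = Graph.V (TorsoH U) ⊎ NewVertex U ; Adj = TorsoStarAdj U }

  IncAdj : (Fin n ⊎ Fin m) → (Fin n ⊎ Fin m) → Set
  IncAdj (inj₁ v) (inj₂ e) = v ∈ edge e
  IncAdj (inj₂ e) (inj₁ v) = v ∈ edge e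
  IncAdj (inj₁ _) (inj₁ _) = ⊥
  IncAdj (inj₂ _) (inj₂ _) = ⊥

  IncidenceGraph : Graph
  IncidenceGraph = record { V = Fin n ⊎ Fin m ; Adj = IncAdj }

  InUInc : Subset n → (Fin n ⊎ Fin m) → Set
  InUInc U (inj₁ v) = v ∈ U
  InUInc U (inj₂ _) = ⊥

IsCycle : ∀ {t} → (Fin t → Fin t → Set) → List (Fin t) → Set
IsCycle A []       = ⊥
IsCycle A (x ∷ xs) = 2 ≤ length xs × Unique (x ∷ xs) × Linked A ((x ∷ xs) ++ (x ∷ []))

record IsTree {t : ℕ} (A : Fin t → Fin t → Set) : Set where
  field
    symmetric   : ∀ i j → A i j → A j i
    irreflexive : ∀ i → ¬ A i i
    connected   : ∀ i j → Walk A (λ _ → ⊤) i j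
    acyclic     : ∀ (c : List (Fin t)) → ¬ IsCycle A c

record TreeDecomposition (G : Graph) (k : ℕ) : Set₁ where
  field
    t      : ℕ
    TAdj   : Fin t → Fin t → Set
    isTree : IsTree TAdj
    bag    : Fin t → List (Graph.V G)
    cover  : ∀ v → ∃ λ i → v ∈L bag i
    edgeCover : ∀ u v → Graph.Adj G u v → ∃ λ i → u ∈L bag i × v ∈L bag i
    subtree : ∀ v i j → v ∈L bag i → v ∈L bag j → Walk TAdj (λ l → v ∈L bag l) i j
    width  : ∀ i → length (bag i) ≤ suc k

TwLe : Graph → ℕ → Set₁
TwLe G k = TreeDecomposition G k

LiftX : (H : Hypergraph) (U X : Subset (Hypergraph.n H)) →
        Graph.V (TorsoStar H U) → Set
LiftX H U X (inj₁ a) = proj₁ a ∈ X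
LiftX H U X (inj₂ _) = ⊥

{-# OPTIONS --safe #-}
module Submission where

-- Two U-vertices of a common hyperedge are adjacent in Torso(H,U).  This gives
-- (1) at once, and (2) because a new vertex u_i on a walk of Torso*(H,U) can be
-- short-cut by a torso edge.  (4) holds because a step inside a hyperedge e is
-- the same as the two-step path through the node e of the incidence graph.
-- For (3), the U-vertices of a hyperedge therefore form a clique of
-- Torso(H,U).  The bags containing a fixed vertex form a subtree, and pairwise
-- intersecting subtrees of a tree have a common node (Helly property), so one
-- bag contains the whole clique.  Hanging from that node a leaf whose bag is
-- the old bag plus u_i, for every new vertex u_i, yields a tree decomposition
-- of Torso*(H,U) whose width is larger by at most one.

open import Defs
open import Data.Nat using (ℕ; suc; _≤_; z≤n; s≤s)
open import Data.Nat.Properties using (m≤n⇒m≤1+n)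
open import Data.Fin using (Fin; zero; suc; _≟_)
open import Data.Fin.Subset using (Subset; _∈_; _∉_; _⊆_; _∩_)
open import Data.Fin.Subset.Properties using (_∈?_; x∈p∩q⁺; x∈p∩q⁻)
open import Data.Vec.Properties.WithK using ([]=-irrelevant)
open import Data.List using (List; []; _∷_; _++_; length; map; allFin; cartesianProduct)
open import Data.List.Properties using (++-assoc; map-++; length-map)
open import Data.List.Membership.Propositional using () renaming (_∈_ to _∈L_)
open import Data.List.Membership.Propositional.Properties
  using (∈-∃++; ∈-++⁺ˡ; ∈-++⁺ʳ; ∈-map⁺; ∈-map⁻; ∈-cartesianProduct⁺; ∈-allFin)
import Data.List.Membership.DecPropositional as DecMembership
open import Data.List.Relation.Unary.Any using (here; there)
open import Data.List.Relation.Unary.All as All using (All; []; _∷_)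
open import Data.List.Relation.Unary.All.Properties using (¬Any⇒All¬)
open import Data.List.Relation.Unary.AllPairs using ([]; _∷_)
open import Data.List.Relation.Unary.Unique.Propositional using (Unique)
open import Data.List.Relation.Unary.Unique.Propositional.Properties
  using (map⁻; cartesianProduct⁺; allFin⁺)
open import Data.List.Relation.Unary.Linked using (Linked; []; [-]; _∷_)
open import Data.Product using (Σ; _×_; _,_; proj₁; proj₂)
open import Data.Sum using (_⊎_; inj₁; inj₂)
open import Data.Sum.Properties using (inj₁-injective)
open import Data.Empty using (⊥; ⊥-elim)
open import Data.Unit using (tt)
open import Function using (_∘_)
open import Function.Bundles using (_⇔_; mk⇔)
open import Relation.Nullary using (¬_; Dec; yes; no)
open import Relation.Unary using (Decidable)
open import Relation.Binary.PropositionalEquality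
  using (_≡_; _≢_; refl; sym; trans; cong; subst; ≢-sym)

module _ {V : Set} {R : V → V → Set} where

  walk-map : {P Q : V → Set} → (∀ {z} → P z → Q z) →
             ∀ {u v} → Walk R P u v → Walk R Q u v
  walk-map f (here p)        = here (f p)
  walk-map f (step p r rest) = step (f p) r (walk-map f rest)

  walk-++ : {P : V → Set} → ∀ {u v w} → Walk R P u v → Walk R P v w → Walk R P u w
  walk-++ (here _)        w = w
  walk-++ (step p r rest) w = step p r (walk-++ rest w)

  walk-start : {P : V → Set} → ∀ {u v} → Walk R P u v → P u
  walk-start (here p)     = p
  walk-start (step p _ _) = p

module _ {A B : Set} where

  inj₂∉map-inj₁ : ∀ {b : B} (xs : List A) → ¬ (inj₂ b ∈L map inj₁ xs)
  inj₂∉map-inj₁ xs b∈ with ∈-map⁻ inj₁ b∈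
  ... | _ , _ , ()

  ∈-map-inj₁⁻ : ∀ {a : A} (xs : List A) → (inj₁ {B = B} a) ∈L map inj₁ xs → a ∈L xs
  ∈-map-inj₁⁻ xs a∈ with ∈-map⁻ inj₁ a∈
  ... | _ , a∈xs , refl = a∈xs

module _ {A : Set} {R : A → A → Set} where

  linked-predecessor : ∀ {y j} ys {zs} → Linked R (y ∷ ys ++ j ∷ zs) →
                       Σ A λ a → R a j × ((a ≡ y × ys ≡ []) ⊎ a ∈L ys)
  linked-predecessor []       (r ∷ _)  = _ , r , inj₁ (refl , refl)
  linked-predecessor (_ ∷ ys) (_ ∷ lk) with linked-predecessor ys lk
  ... | a , r , inj₁ (refl , refl) = a , r , inj₂ (here refl)
  ... | a , r , inj₂ a∈ys          = a , r , inj₂ (there a∈ys)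

  linked-successor : ∀ ys {j w zs} → Linked R (ys ++ j ∷ w ∷ zs) → R j w
  linked-successor []            (r ∷ _)  = r
  linked-successor (_ ∷ [])      (_ ∷ lk) = linked-successor [] lk
  linked-successor (_ ∷ y ∷ ys)  (_ ∷ lk) = linked-successor (y ∷ ys) lk

  unique-++-disjoint : ∀ ys {zs} {a : A} → Unique (ys ++ zs) → a ∈L ys → ¬ a ∈L zs
  unique-++-disjoint (_ ∷ ys) (y∉ ∷ _) (here refl)  a∈zs = All.lookup y∉ (∈-++⁺ʳ ys a∈zs) refl
  unique-++-disjoint (_ ∷ ys) (_ ∷ un) (there a∈ys) a∈zs = unique-++-disjoint ys un a∈ys a∈zs

  -- The two neighbours of j on a cycle would both be q.
  leaf-¬cycle : (j q : A) → (∀ y → R j y → y ≡ q) → (∀ y → R y j → y ≡ q) →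
                ∀ x xs → j ∈L (x ∷ xs) → 2 ≤ length xs → Unique (x ∷ xs) →
                ¬ Linked R ((x ∷ xs) ++ x ∷ [])
  leaf-¬cycle j q out into .j (y ∷ []) (here refl) (s≤s ()) _ _
  leaf-¬cycle j q out into .j (y ∷ y′ ∷ ys) (here refl) _ ((_ ∷ _) ∷ (y∉ ∷ _)) (r ∷ lk)
    with linked-predecessor (y′ ∷ ys) lk
  ... | a , raj , inj₂ a∈ = All.lookup y∉ a∈ (trans (out y r) (sym (into a raj)))
  leaf-¬cycle j q out into x xs (there j∈xs) len (x∉ ∷ un) lk with ∈-∃++ j∈xs
  ... | pre , post , refl =
    around pre post len x∉ un
      (subst (λ l → Linked R (x ∷ l)) (++-assoc pre (j ∷ post) (x ∷ [])) lk)
    where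
      around : ∀ pre post → 2 ≤ length (pre ++ j ∷ post) → All (x ≢_) (pre ++ j ∷ post) →
               Unique (pre ++ j ∷ post) → ¬ Linked R (x ∷ pre ++ j ∷ (post ++ x ∷ []))
      around pre post len x∉ un lk with linked-predecessor pre lk
      around .[] [] (s≤s ()) _ _ _ | _ , _ , inj₁ (refl , refl)
      around .[] (w ∷ post) _ x∉ _ lk | a , raj , inj₁ (refl , refl) =
        All.lookup x∉ (there (here refl))
          (trans (into a raj) (sym (out w (linked-successor (a ∷ []) lk))))
      around pre [] _ x∉ _ lk | a , raj , inj₂ a∈pre =
        All.lookup x∉ (∈-++⁺ˡ a∈pre)
          (trans (out x (linked-successor (x ∷ pre) lk)) (sym (into a raj)))
      around pre (w ∷ post) _ _ un lk | a , raj , inj₂ a∈pre =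
        unique-++-disjoint pre un a∈pre
          (there (here (trans (into a raj) (sym (out w (linked-successor (x ∷ pre) lk))))))

module Subtrees {t : ℕ} (R : Fin t → Fin t → Set) (acyclic : ∀ c → ¬ IsCycle R c) where

  open DecMembership (_≟_ {t}) using () renaming (_∈?_ to _∈L?_)

  data Path : Fin t → List (Fin t) → Fin t → Set where
    ε   : ∀ {u} → Path u [] u
    _◅_ : ∀ {u w xs v} → R u w → Path w xs v → Path u (w ∷ xs) v

  SimplePath : (Fin t → Set) → Fin t → Fin t → Set
  SimplePath P u v = Σ (List (Fin t)) λ xs → Path u xs v × Unique (u ∷ xs) × All P (u ∷ xs)

  suffix : ∀ {P u w xs v} → u ∈L (w ∷ xs) → Path w xs v → Unique (w ∷ xs) →
           All P (w ∷ xs) → SimplePath P u v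
  suffix (here refl) π       un       ps       = _ , π , un , ps
  suffix (there u∈)  (_ ◅ π) (_ ∷ un) (_ ∷ ps) = suffix u∈ π un ps

  simplify : ∀ {P u v} → Walk R P u v → SimplePath P u v
  simplify (here p) = [] , ε , [] ∷ [] , p ∷ []
  simplify {u = u} (step p r rest) with simplify rest
  ... | xs , π , un , ps with u ∈L? (_ ∷ xs)
  ...   | yes u∈ = suffix u∈ π un ps
  ...   | no u∉  = _ ∷ xs , r ◅ π , ¬Any⇒All¬ _ u∉ ∷ un , p ∷ ps

  path→walk : ∀ {P u xs v} → Path u xs v → All P (u ∷ xs) → Walk R P u v
  path→walk ε       (p ∷ []) = here p
  path→walk (r ◅ π) (p ∷ ps) = step p r (path→walk π ps)

  path-closing : ∀ {u xs v a} → Path u xs v → R v a → Linked R (u ∷ xs ++ a ∷ [])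
  path-closing ε       r′ = r′ ∷ [-]
  path-closing (r ◅ π) r′ = r ∷ path-closing π r′

  path-target-∈ : ∀ {u xs v} → Path u xs v → v ∈L (u ∷ xs)
  path-target-∈ ε       = here refl
  path-target-∈ (_ ◅ π) = there (path-target-∈ π)

  ¬detour : ∀ {a w b} → R a w → w ≢ b → Walk R (_≢ a) w b → ¬ R b a
  ¬detour {a} raw w≢b w⇝b rba with simplify w⇝b
  ... | []    , ε , _  , _  = w≢b refl
  ... | y ∷ ys , π , un , ps =
    acyclic (a ∷ _ ∷ y ∷ ys)
      (s≤s (s≤s z≤n) , All.map ≢-sym ps ∷ un , raw ∷ path-closing π rba)

  first-arrival : ∀ {Q x c} → Walk R Q x c → x ≢ c →
                  Σ (Fin t) λ b → Q b × R b c × Walk R (λ z → Q z × z ≢ c) x b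
  first-arrival (here _) x≢c = ⊥-elim (x≢c refl)
  first-arrival {c = c} (step {w = w} qx r rest) x≢c with w ≟ c
  ... | yes refl = _ , qx , r , here (qx , x≢c)
  ... | no w≢c with first-arrival rest w≢c
  ...   | b , qb , rbc , x⇝b = b , qb , rbc , step (qx , x≢c) r x⇝b

  Connected : (Fin t → Set) → Set
  Connected S = ∀ i j → S i → S j → Walk R S i j

  -- If the path left S at some step, continuing to b and returning to a inside
  -- S would close a cycle.
  simple-path-inside : ∀ {S a xs b} → Connected S → Decidable S → Path a xs b →
                       Unique (a ∷ xs) → S a → S b → All S xs
  simple-path-inside cS dS ε _ _ _ = []
  simple-path-inside {S} {a} {w ∷ _} {b} cS dS (r ◅ π) (a∉ ∷ un) sa sb with dS w
  ... | yes sw = sw ∷ simple-path-inside cS dS π un sw sb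
  ... | no ¬sw with first-arrival (cS b a sb sa) (All.lookup (All.map ≢-sym a∉) (path-target-∈ π))
  ...   | c , sc , rca , b⇝c = ⊥-elim
    (¬detour r (λ { refl → ¬sw sc })
      (walk-++ (path→walk π (All.map ≢-sym a∉)) (walk-map proj₂ b⇝c)) rca)

  ∩-connected : ∀ {S T} → Connected S → Connected T → Decidable T →
                Connected (λ z → S z × T z)
  ∩-connected cS cT dT i j (si , ti) (sj , tj) with simplify (cS i j si sj)
  ... | _ , π , un , _ ∷ sxs =
    path→walk π ((si , ti) ∷ All.zip (sxs , simple-path-inside cT dT π un ti tj))

  module _ {S₁ S₂ S₃ : Fin t → Set} (d₂ : Decidable S₂) (d₃ : Decidable S₃) where

    Meet : Set
    Meet = Σ (Fin t) λ z → S₁ z × S₂ z × S₃ z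

    LastExit : Fin t → Set
    LastExit v = Σ (Fin t) λ c → Σ (Fin t) λ w →
                 S₂ c × ¬ S₃ c × R c w × Walk R (λ z → ¬ S₂ z) w v

    meet-or-exit : ∀ {u v} → Walk R S₁ u v → S₃ v →
                   Meet ⊎ LastExit v ⊎ Walk R (λ z → ¬ S₂ z) u v
    meet-or-exit (here s₁) s₃ with d₂ _
    ... | yes s₂ = inj₁ (_ , s₁ , s₂ , s₃)
    ... | no ¬s₂ = inj₂ (inj₂ (here ¬s₂))
    meet-or-exit {u} (step s₁ r rest) s₃ with meet-or-exit rest s₃
    ... | inj₁ meet        = inj₁ meet
    ... | inj₂ (inj₁ exit) = inj₂ (inj₁ exit)
    ... | inj₂ (inj₂ w⇝v) with d₂ u
    ...   | no ¬s₂ = inj₂ (inj₂ (step ¬s₂ r w⇝v))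
    ...   | yes s₂ with d₃ u
    ...     | yes s₃u = inj₁ (u , s₁ , s₂ , s₃u)
    ...     | no ¬s₃u = inj₂ (inj₁ (u , _ , s₂ , ¬s₃u , r , w⇝v))

  -- The S₁-walk from x₁₂ to x₁₃ either meets S₂ ∩ S₃ or leaves S₂ for the last
  -- time at some c ∉ S₃; going on to x₁₃ and back to c through S₃ and S₂ would
  -- then close a cycle.
  helly₃ : ∀ {S₁ S₂ S₃} → Connected S₁ → Connected S₂ → Connected S₃ →
           Decidable S₂ → Decidable S₃ →
           ∀ {x₁₂ x₁₃ x₂₃} → S₁ x₁₂ → S₂ x₁₂ → S₁ x₁₃ → S₃ x₁₃ → S₂ x₂₃ → S₃ x₂₃ →
           Σ (Fin t) λ z → S₁ z × S₂ z × S₃ z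
  helly₃ {S₁} {S₂} {S₃} c₁ c₂ c₃ d₂ d₃ {x₁₂} {x₁₃} {x₂₃} s₁ s₂ s₁′ s₃ s₂′ s₃′
    with meet-or-exit {S₁} {S₂} {S₃} d₂ d₃ (c₁ x₁₂ x₁₃ s₁ s₁′) s₃
  ... | inj₁ meet         = meet
  ... | inj₂ (inj₂ x⇝x₁₃) = ⊥-elim (walk-start x⇝x₁₃ s₂)
  ... | inj₂ (inj₁ (c , w , s₂c , ¬s₃c , rcw , w⇝x₁₃))
    with first-arrival (c₂ x₂₃ c s₂′ s₂c) (λ { refl → ¬s₃c s₃′ })
  ...   | b , s₂b , rbc , x₂₃⇝b = ⊥-elim
    (¬detour rcw (λ { refl → walk-start w⇝x₁₃ s₂b })
      (walk-++ (walk-map (λ ¬s₂z → ¬s₂z ∘ λ { refl → s₂c }) w⇝x₁₃)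
        (walk-++ (walk-map (λ s₃z → λ { refl → ¬s₃c s₃z }) (c₃ x₁₃ x₂₃ s₃ s₃′))
          (walk-map proj₂ x₂₃⇝b)))
      rbc)

  helly : {I : Set} (S : I → Fin t → Set) → (∀ i → Connected (S i)) →
          (∀ i → Decidable (S i)) →
          (T : Fin t → Set) → Connected T → ∀ {z} → T z → (K : List I) →
          (∀ i → i ∈L K → Σ (Fin t) λ l → T l × S i l) →
          (∀ i j → i ∈L K → j ∈L K → Σ (Fin t) λ l → S i l × S j l) →
          Σ (Fin t) λ l → T l × All (λ i → S i l) K
  helly S cS dS T cT tz []      _     _     = _ , tz , []
  helly S cS dS T cT tz (i ∷ K) meetT meetS = extend (meetT i (here refl))
    where
      extend : Σ (Fin t) (λ l → T l × S i l) → Σ (Fin t) λ l → T l × All (λ j → S j l) (i ∷ K)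
      extend (z′ , tz′ , iz′)
        with helly S cS dS (λ l → T l × S i l) (∩-connected cT (cS i) (dS i)) (tz′ , iz′) K
               meetTi (λ a b a∈ b∈ → meetS a b (there a∈) (there b∈))
        where
          meetTi : ∀ j → j ∈L K → Σ (Fin t) λ l → (T l × S i l) × S j l
          meetTi j j∈ with meetT j (there j∈) | meetS i j (here refl) (there j∈)
          ... | _ , tj , jj | _ , ij , ji
            with helly₃ cT (cS i) (cS j) (dS i) (dS j) tz′ iz′ tj jj ij ji
          ...   | l , tl , il , jl = l , (tl , il) , jl
      ... | l , (tl , il) , all = l , tl , il ∷ all

module AddLeaf {t : ℕ} (R : Fin t → Fin t → Set) (p : Fin t) where

  R⁺ : Fin (suc t) → Fin (suc t) → Set
  R⁺ zero    zero    = ⊥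
  R⁺ zero    (suc b) = b ≡ p
  R⁺ (suc a) zero    = a ≡ p
  R⁺ (suc a) (suc b) = R a b

  lift-walk : {P : Fin t → Set} {Q : Fin (suc t) → Set} → (∀ {a} → P a → Q (suc a)) →
              ∀ {a b} → Walk R P a b → Walk R⁺ Q (suc a) (suc b)
  lift-walk f (here pa)       = here (f pa)
  lift-walk f (step pa r rest) = step (f pa) r (lift-walk f rest)

  unmap-suc : (l : List (Fin (suc t))) → ¬ zero ∈L l → Σ (List (Fin t)) λ l′ → l ≡ map suc l′
  unmap-suc []          _    = [] , refl
  unmap-suc (zero ∷ l)  0∉   = ⊥-elim (0∉ (here refl))
  unmap-suc (suc a ∷ l) 0∉ with unmap-suc l (0∉ ∘ there)
  ... | l′ , refl = a ∷ l′ , refl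

  linked-unmap : ∀ l → Linked R⁺ (map suc l) → Linked R l
  linked-unmap []          _        = []
  linked-unmap (_ ∷ [])    _        = [-]
  linked-unmap (_ ∷ b ∷ l) (r ∷ lk) = r ∷ linked-unmap (b ∷ l) lk

  isTree⁺ : IsTree R → IsTree R⁺
  isTree⁺ T = record
    { symmetric = symmetric ; irreflexive = irreflexive ; connected = connected ; acyclic = acyclic }
    where
      module T = IsTree T

      symmetric : ∀ i j → R⁺ i j → R⁺ j i
      symmetric zero    (suc _) e = e
      symmetric (suc _) zero    e = e
      symmetric (suc a) (suc b) r = T.symmetric a b r

      irreflexive : ∀ i → ¬ R⁺ i i
      irreflexive zero    ()
      irreflexive (suc a) = T.irreflexive a

      connected : ∀ i j → Walk R⁺ _ i j
      connected zero    zero    = here tt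
      connected zero    (suc b) = step tt refl (lift-walk _ (T.connected p b))
      connected (suc a) zero    = walk-++ (lift-walk _ (T.connected a p)) (step tt refl (here tt))
      connected (suc a) (suc b) = lift-walk _ (T.connected a b)

      from-leaf : ∀ y → R⁺ zero y → y ≡ suc p
      from-leaf (suc _) refl = refl

      to-leaf : ∀ y → R⁺ y zero → y ≡ suc p
      to-leaf (suc _) refl = refl

      acyclic-old : ∀ l → ¬ IsCycle R⁺ (map suc l)
      acyclic-old (x ∷ xs) (len , un , lk) =
        T.acyclic (x ∷ xs)
          ( subst (2 ≤_) (length-map suc xs) len
          , map⁻ un
          , linked-unmap ((x ∷ xs) ++ x ∷ [])
              (subst (Linked R⁺) (sym (map-++ suc (x ∷ xs) (x ∷ []))) lk) )

      acyclic : ∀ c → ¬ IsCycle R⁺ c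
      acyclic (x ∷ xs) (len , un , lk) with DecMembership._∈?_ _≟_ zero (x ∷ xs)
      ... | yes 0∈ = leaf-¬cycle zero (suc p) from-leaf to-leaf x xs 0∈ len un lk
      ... | no  0∉ with unmap-suc (x ∷ xs) 0∉
      ...   | l′ , eq = acyclic-old l′ (subst (IsCycle R⁺) eq (len , un , lk))

module _ (H : Hypergraph) (U : Subset (Hypergraph.n H)) where
  open Hypergraph H

  private
    V : Set
    V = Graph.V (TorsoH H U)

    V* : Set
    V* = Graph.V (TorsoStar H U)

  ≡-from-vertex : (a b : V) → proj₁ a ≡ proj₁ b → a ≡ b
  ≡-from-vertex (g , g∈) (.g , g∈′) refl = cong (g ,_) ([]=-irrelevant g∈ g∈′)

  _≟V_ : (a b : V) → Dec (a ≡ b)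
  a ≟V b with proj₁ a ≟ proj₁ b
  ... | yes eq = yes (≡-from-vertex a b eq)
  ... | no  ne = no (ne ∘ cong proj₁)

  hyperedge-adjacent : ∀ i (a b : V) → proj₁ a ≢ proj₁ b →
                       proj₁ a ∈ edge i → proj₁ b ∈ edge i → Graph.Adj (TorsoH H U) a b
  hyperedge-adjacent i a b ne a∈ b∈ = ne , direct (i , a∈ , b∈)

  new-vertex-simplicial : ∀ (x : NewVertex H U) (v₁ v₂ : V) → proj₁ v₁ ≢ proj₁ v₂ →
                          Graph.Adj (TorsoStar H U) (inj₂ x) (inj₁ v₁) →
                          Graph.Adj (TorsoStar H U) (inj₂ x) (inj₁ v₂) →
                          Graph.Adj (TorsoH H U) v₁ v₂
  new-vertex-simplicial x = hyperedge-adjacent (proj₁ x)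

  module _ (X : Subset n) where

    torsoStar-walk⇒torso-walk :
      ∀ {a b} → Walk (Graph.Adj (TorsoStar H U)) (λ w → ¬ LiftX H U X w) (inj₁ a) (inj₁ b) →
      Walk (Graph.Adj (TorsoH H U)) (λ w → proj₁ w ∉ X) a b
    torsoStar-walk⇒torso-walk (here a∉) = here a∉
    torsoStar-walk⇒torso-walk (step {w = inj₁ _} a∉ r rest) =
      step a∉ r (torsoStar-walk⇒torso-walk rest)
    torsoStar-walk⇒torso-walk (step {w = inj₂ _} _ _ (step {w = inj₂ _} _ () _))
    torsoStar-walk⇒torso-walk {a} (step {w = inj₂ x} a∉ r (step {w = inj₁ c} _ r′ rest))
      with proj₁ a ≟ proj₁ c
    ... | yes eq rewrite ≡-from-vertex a c eq = torsoStar-walk⇒torso-walk rest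
    ... | no  ne = step a∉ (new-vertex-simplicial x a c ne r r′) (torsoStar-walk⇒torso-walk rest)

    torso-walk⇒torsoStar-walk :
      ∀ {a b} → Walk (Graph.Adj (TorsoH H U)) (λ w → proj₁ w ∉ X) a b →
      Walk (Graph.Adj (TorsoStar H U)) (λ w → ¬ LiftX H U X w) (inj₁ a) (inj₁ b)
    torso-walk⇒torsoStar-walk (here a∉)        = here a∉
    torso-walk⇒torsoStar-walk (step a∉ r rest) = step a∉ r (torso-walk⇒torsoStar-walk rest)

  torso-separator⇔torsoStar-separator :
    ∀ (u₁ u₂ : V) (X : Subset n) →
    Separator (TorsoH H U) (λ a → proj₁ a ∈ X) u₁ u₂
    ⇔ Separator (TorsoStar H U) (LiftX H U X) (inj₁ u₁) (inj₁ u₂)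
  torso-separator⇔torsoStar-separator u₁ u₂ X = mk⇔
    (λ (u₁∉ , u₂∉ , ¬walk) → u₁∉ , u₂∉ , ¬walk ∘ torsoStar-walk⇒torso-walk X)
    (λ (u₁∉ , u₂∉ , ¬walk) → u₁∉ , u₂∉ , ¬walk ∘ torso-walk⇒torsoStar-walk X)

  inner-path⇒incidence-inner-path :
    ∀ {x y} → InnerPath (HStep H) (_∉ U) x y →
    InnerPath (IncAdj H) (λ w → ¬ InUInc H U w) (inj₁ x) (inj₁ y)
  inner-path⇒incidence-inner-path (direct (i , x∈ , y∈)) =
    via {w = inj₂ i} x∈ (λ ()) (direct y∈)
  inner-path⇒incidence-inner-path (via (i , x∈ , w∈) w∉ rest) =
    via {w = inj₂ i} x∈ (λ ()) (via w∈ w∉ (inner-path⇒incidence-inner-path rest))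

  incidence-inner-path⇒inner-path :
    ∀ {x y} → InnerPath (IncAdj H) (λ w → ¬ InUInc H U w) (inj₁ x) (inj₁ y) →
    InnerPath (HStep H) (_∉ U) x y
  incidence-inner-path⇒inner-path (direct ())
  incidence-inner-path⇒inner-path (via {w = inj₁ _} () _ _)
  incidence-inner-path⇒inner-path (via {w = inj₂ i} x∈ _ (direct y∈)) = direct (i , x∈ , y∈)
  incidence-inner-path⇒inner-path (via {w = inj₂ _} _ _ (via {w = inj₂ _} () _ _))
  incidence-inner-path⇒inner-path (via {w = inj₂ i} x∈ _ (via {w = inj₁ _} w∈ w∉ rest)) =
    via (i , x∈ , w∈) w∉ (incidence-inner-path⇒inner-path rest)

  torso-adj⇔incidence-torso-adj :
    ∀ (a b : V) → Graph.Adj (TorsoH H U) a b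
      ⇔ Graph.Adj (Torso (IncidenceGraph H) (InUInc H U))
          (inj₁ (proj₁ a) , proj₂ a) (inj₁ (proj₁ b) , proj₂ b)
  torso-adj⇔incidence-torso-adj a b = mk⇔
    (λ (ne , π) → ne ∘ inj₁-injective , inner-path⇒incidence-inner-path π)
    (λ (ne , π) → ne ∘ cong inj₁ , incidence-inner-path⇒inner-path π)

  -- NewVertex records a witness of e_i ∩ U ≠ ∅, so Torso*(H,U) has one new
  -- vertex for every pair (i , f) with f ∈ e_i ∩ U; they are enumerated by
  -- running through all pairs (i , f).
  label : NewVertex H U → Fin m × Fin n
  label (i , f , _) = i , f

  module _ {k : ℕ} (td : TreeDecomposition (TorsoH H U) k) where
    private module D = TreeDecomposition td

    in-hyperedge : Fin m → List (Fin n) → List V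
    in-hyperedge i []       = []
    in-hyperedge i (g ∷ gs) with g ∈? (edge i ∩ U)
    ... | yes g∈ = (g , proj₂ (x∈p∩q⁻ (edge i) U g∈)) ∷ in-hyperedge i gs
    ... | no  _  = in-hyperedge i gs

    in-hyperedge-sound : ∀ i gs {a} → a ∈L in-hyperedge i gs → proj₁ a ∈ edge i
    in-hyperedge-sound i (g ∷ gs) a∈ with g ∈? (edge i ∩ U) | a∈
    ... | yes g∈ | here refl  = proj₁ (x∈p∩q⁻ (edge i) U g∈)
    ... | yes _  | there a∈′ = in-hyperedge-sound i gs a∈′
    ... | no  _  | a∈′        = in-hyperedge-sound i gs a∈′

    in-hyperedge-complete : ∀ i gs (a : V) → proj₁ a ∈L gs → proj₁ a ∈ edge i →
                            a ∈L in-hyperedge i gs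
    in-hyperedge-complete i (g ∷ gs) a a∈ a∈i with g ∈? (edge i ∩ U) | a∈
    ... | yes _  | here eq    = here (≡-from-vertex a _ eq)
    ... | yes _  | there a∈′ = there (in-hyperedge-complete i gs a a∈′ a∈i)
    ... | no  g∉ | here refl  = ⊥-elim (g∉ (x∈p∩q⁺ (a∈i , proj₂ a)))
    ... | no  _  | there a∈′ = in-hyperedge-complete i gs a a∈′ a∈i

    common-bag : ∀ i (a b : V) → proj₁ a ∈ edge i → proj₁ b ∈ edge i →
                 Σ (Fin D.t) λ l → a ∈L D.bag l × b ∈L D.bag l
    common-bag i a b a∈ b∈ with proj₁ a ≟ proj₁ b
    ... | no ne = D.edgeCover a b (hyperedge-adjacent i a b ne a∈ b∈)
    ... | yes eq with ≡-from-vertex a b eq | D.cover a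
    ...   | refl | l , a∈l = l , a∈l , a∈l

    hyperedge-bag : ∀ i (a₀ : V) → proj₁ a₀ ∈ edge i →
                    Σ (Fin D.t) λ l → ∀ (a : V) → proj₁ a ∈ edge i → a ∈L D.bag l
    hyperedge-bag i a₀ a₀∈
      with Subtrees.helly D.TAdj (IsTree.acyclic D.isTree)
             (λ a l → a ∈L D.bag l) D.subtree (λ a l → DecMembership._∈?_ _≟V_ a (D.bag l))
             (λ l → a₀ ∈L D.bag l) (D.subtree a₀) (proj₂ (D.cover a₀))
             (in-hyperedge i (allFin n))
             (λ b b∈ → common-bag i a₀ b a₀∈ (in-hyperedge-sound i (allFin n) b∈))
             (λ a b a∈ b∈ → common-bag i a b (in-hyperedge-sound i (allFin n) a∈)
                                            (in-hyperedge-sound i (allFin n) b∈))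
    ... | l , _ , all =
      l , λ a a∈i → All.lookup all (in-hyperedge-complete i (allFin n) a (∈-allFin (proj₁ a)) a∈i)

    record Extension (ps : List (Fin m × Fin n)) : Set₁ where
      field
        t           : ℕ
        R           : Fin t → Fin t → Set
        tree        : IsTree R
        bag         : Fin t → List V*
        emb         : Fin D.t → Fin t
        bag-emb     : ∀ l → bag (emb l) ≡ map inj₁ (D.bag l)
        subtree     : ∀ v i j → v ∈L bag i → v ∈L bag j → Walk R (λ l → v ∈L bag l) i j
        width       : ∀ i → length (bag i) ≤ suc (suc k)
        new-listed  : ∀ x l → inj₂ x ∈L bag l → label x ∈L ps
        new-covered : ∀ x → label x ∈L ps → Σ (Fin t) λ l → inj₂ x ∈L bag l ×
                        (∀ (a : V) → proj₁ a ∈ edge (proj₁ x) → inj₁ a ∈L bag l)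

    base : Extension []
    base = record
      { t = D.t ; R = D.TAdj ; tree = D.isTree ; bag = bag₀ ; emb = λ l → l
      ; bag-emb = λ _ → refl ; subtree = subtree₀
      ; width = λ l → subst (_≤ suc (suc k)) (sym (length-map inj₁ (D.bag l)))
                            (m≤n⇒m≤1+n (D.width l))
      ; new-listed = λ _ l x∈ → ⊥-elim (inj₂∉map-inj₁ (D.bag l) x∈)
      ; new-covered = λ _ () }
      where
        bag₀ : Fin D.t → List V*
        bag₀ l = map inj₁ (D.bag l)

        subtree₀ : ∀ v i j → v ∈L bag₀ i → v ∈L bag₀ j → Walk D.TAdj (λ l → v ∈L bag₀ l) i j
        subtree₀ (inj₁ a) i j a∈i a∈j =
          walk-map (∈-map⁺ inj₁) (D.subtree a i j (∈-map-inj₁⁻ _ a∈i) (∈-map-inj₁⁻ _ a∈j))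
        subtree₀ (inj₂ _) i _ x∈ _ = ⊥-elim (inj₂∉map-inj₁ _ x∈)

    skip : ∀ {ps i f} → Extension ps → f ∉ edge i ∩ U → Extension ((i , f) ∷ ps)
    skip {ps} {i} {f} E f∉ = record
      { Extension E ; new-listed = λ x l x∈ → there (E.new-listed x l x∈) ; new-covered = covered }
      where
        module E = Extension E
        covered : ∀ x → label x ∈L ((i , f) ∷ ps) → _
        covered (_ , _ , f∈) (here refl) = ⊥-elim (f∉ f∈)
        covered x            (there x∈)  = E.new-covered x x∈

    attach : ∀ {ps} → Extension ps → (x₀ : NewVertex H U) → All (label x₀ ≢_) ps →
             Extension (label x₀ ∷ ps)
    attach {ps} E (i , f , f∈iU) fresh
      with hyperedge-bag i (f , proj₂ (x∈p∩q⁻ (edge i) U f∈iU)) (proj₁ (x∈p∩q⁻ (edge i) U f∈iU))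
    ... | p₀ , clique = record
      { t = suc E.t ; R = R⁺ ; tree = isTree⁺ E.tree ; bag = bag⁺ ; emb = suc ∘ E.emb
      ; bag-emb = E.bag-emb ; subtree = subtree⁺ ; width = width⁺
      ; new-listed = listed⁺ ; new-covered = covered⁺ }
      where
        module E = Extension E
        open AddLeaf E.R (E.emb p₀)

        x₀ : NewVertex H U
        x₀ = i , f , f∈iU

        bag⁺ : Fin (suc E.t) → List V*
        bag⁺ zero    = inj₂ x₀ ∷ map inj₁ (D.bag p₀)
        bag⁺ (suc l) = E.bag l

        width⁺ : ∀ l → length (bag⁺ l) ≤ suc (suc k)
        width⁺ zero    = s≤s (subst (_≤ suc k) (sym (length-map inj₁ (D.bag p₀))) (D.width p₀))
        width⁺ (suc l) = E.width l

        stale : ∀ l → ¬ inj₂ x₀ ∈L E.bag l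
        stale l x₀∈ = All.lookup fresh (E.new-listed x₀ l x₀∈) refl

        listed⁺ : ∀ x l → inj₂ x ∈L bag⁺ l → label x ∈L (label x₀ ∷ ps)
        listed⁺ _ zero    (here refl) = here refl
        listed⁺ _ zero    (there x∈)  = ⊥-elim (inj₂∉map-inj₁ (D.bag p₀) x∈)
        listed⁺ x (suc l) x∈          = there (E.new-listed x l x∈)

        covered⁺ : ∀ x → label x ∈L (label x₀ ∷ ps) →
                   Σ (Fin (suc E.t)) λ l → inj₂ x ∈L bag⁺ l ×
                     (∀ (a : V) → proj₁ a ∈ edge (proj₁ x) → inj₁ a ∈L bag⁺ l)
        covered⁺ (_ , _ , f∈) (here refl) =
          zero , here (cong (λ f∈′ → inj₂ (i , f , f∈′)) ([]=-irrelevant f∈ f∈iU)) ,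
          λ a a∈i → there (∈-map⁺ inj₁ (clique a a∈i))
        covered⁺ x (there x∈) with E.new-covered x x∈
        ... | l , x∈l , clique-l = suc l , x∈l , clique-l

        at-p₀ : ∀ {v} → v ∈L map inj₁ (D.bag p₀) → v ∈L E.bag (E.emb p₀)
        at-p₀ {v} = subst (v ∈L_) (sym (E.bag-emb p₀))

        subtree⁺ : ∀ v i j → v ∈L bag⁺ i → v ∈L bag⁺ j → Walk R⁺ (λ l → v ∈L bag⁺ l) i j
        subtree⁺ v zero    zero    v∈ _ = here v∈
        subtree⁺ v (suc a) (suc b) v∈a v∈b = lift-walk (λ v∈ → v∈) (E.subtree v a b v∈a v∈b)
        subtree⁺ _ zero    (suc b) (here refl) v∈b = ⊥-elim (stale b v∈b)
        subtree⁺ v zero    (suc b) (there v∈) v∈b =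
          step (there v∈) refl (lift-walk (λ v∈ → v∈) (E.subtree v _ b (at-p₀ v∈) v∈b))
        subtree⁺ _ (suc a) zero    v∈a (here refl) = ⊥-elim (stale a v∈a)
        subtree⁺ v (suc a) zero    v∈a (there v∈) =
          walk-++ (lift-walk (λ v∈ → v∈) (E.subtree v a _ v∈a (at-p₀ v∈)))
                  (step (at-p₀ v∈) refl (here (there v∈)))

    extension : ∀ ps → Unique ps → Extension ps
    extension []             _             = base
    extension ((i , f) ∷ ps) (fresh ∷ un) with f ∈? (edge i ∩ U)
    ... | yes f∈ = attach (extension ps un) (i , f , f∈) fresh
    ... | no  f∉ = skip (extension ps un) f∉

    torsoStar-treeDecomposition : TreeDecomposition (TorsoStar H U) (suc k)
    torsoStar-treeDecomposition = record
      { t = E.t ; TAdj = E.R ; isTree = E.tree ; bag = E.bag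
      ; cover = cover ; edgeCover = edgeCover ; subtree = E.subtree ; width = E.width }
      where
        all-labels : List (Fin m × Fin n)
        all-labels = cartesianProduct (allFin m) (allFin n)

        E : Extension all-labels
        E = extension all-labels (cartesianProduct⁺ (allFin⁺ m) (allFin⁺ n))
        module E = Extension E

        listed : ∀ x → label x ∈L all-labels
        listed (i , f , _) = ∈-cartesianProduct⁺ (∈-allFin i) (∈-allFin f)

        old-in : ∀ {a l} → a ∈L D.bag l → inj₁ a ∈L E.bag (E.emb l)
        old-in {a} {l} a∈ = subst (inj₁ a ∈L_) (sym (E.bag-emb l)) (∈-map⁺ inj₁ a∈)

        cover : ∀ v → Σ (Fin E.t) λ l → v ∈L E.bag l
        cover (inj₁ a) with D.cover a
        ... | l , a∈ = E.emb l , old-in a∈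
        cover (inj₂ x) with E.new-covered x (listed x)
        ... | l , x∈ , _ = l , x∈

        edgeCover : ∀ u v → Graph.Adj (TorsoStar H U) u v →
                    Σ (Fin E.t) λ l → u ∈L E.bag l × v ∈L E.bag l
        edgeCover (inj₁ a) (inj₁ b) adj with D.edgeCover a b adj
        ... | l , a∈ , b∈ = E.emb l , old-in a∈ , old-in b∈
        edgeCover (inj₁ a) (inj₂ x) a∈x with E.new-covered x (listed x)
        ... | l , x∈ , clique = l , clique a a∈x , x∈
        edgeCover (inj₂ x) (inj₁ a) a∈x with E.new-covered x (listed x)
        ... | l , x∈ , clique = l , x∈ , clique a a∈x
        edgeCover (inj₂ _) (inj₂ _) ()

mainTheorem17 : (H : Hypergraph) (U : Subset (Hypergraph.n H)) →
    -- (1) new vertices of Torso* are simplicial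
    ( ∀ (x : NewVertex H U) (v₁ v₂ : Graph.V (TorsoH H U)) →
        proj₁ v₁ ≢ proj₁ v₂ →
        Graph.Adj (TorsoStar H U) (inj₂ x) (inj₁ v₁) →
        Graph.Adj (TorsoStar H U) (inj₂ x) (inj₁ v₂) →
        Graph.Adj (TorsoH H U) v₁ v₂ )
    ×
    -- (2) separators in Torso and Torso* agree
    ( ∀ (u₁ u₂ : Graph.V (TorsoH H U)) (X : Subset (Hypergraph.n H)) →
        X ⊆ U → proj₁ u₁ ∉ X → proj₁ u₂ ∉ X →
        ( Separator (TorsoH H U) (λ a → proj₁ a ∈ X) u₁ u₂
          ⇔ Separator (TorsoStar H U)
              (LiftX H U X)
              (inj₁ u₁) (inj₁ u₂) ) )
    ×
    -- (3) tw(Torso*) ≤ tw(Torso) + 1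
    ( ∀ (k : ℕ) → TwLe (TorsoH H U) k → TwLe (TorsoStar H U) (suc k) )
    ×
    -- (4) Torso(H,U) = Torso(G,U) for the incidence graph G
    ( ∀ (a b : Graph.V (TorsoH H U)) →
        Graph.Adj (TorsoH H U) a b
        ⇔ Graph.Adj (Torso (IncidenceGraph H) (InUInc H U))
            (inj₁ (proj₁ a) , proj₂ a) (inj₁ (proj₁ b) , proj₂ b) )
mainTheorem17 H U =
    new-vertex-simplicial H U
  , (λ u₁ u₂ X _ _ _ → torso-separator⇔torsoStar-separator H U u₁ u₂ X)
  , (λ _ → torsoStar-treeDecomposition H U)
  , torso-adj⇔incidence-torso-adj H U
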